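{- Let $S$ and $T$ be finite regular semigroups, let $\psi:S\to T$ be an injective homomorphism, and suppose that all elements of $S$ are pairwise comparable in the $\leq_{\mathscr J}$-preorder of $S$. Then for all $x,y\in S$, $x\leq_{\mathscr J}y$ in $S$ if and only if $x\psi\leq_{\mathscr J}y\psi$ in $T$.
   Context: A semigroup is regular if every element $x$ satisfies $x=xyx$ for some $y$. In a semigroup $S$, $x\leq_{\mathscr J}y$ means $x\in S^1yS^1$, where $S^1$ is $S$ with an identity adjoined if necessary. -}

module Defs where

open import Level using (Level; _⊔_)
open import Algebra.Bundles using (Semigroup)
open import Data.Nat using (ℕ)
open import Data.Fin using (Fin)
open import Data.Product using (Σ; ∃; _×_; _,_)
open import Data.Sum using (_⊎_)

module _ {c ℓ : Level} (S : Semigroup c ℓ) where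
  open Semigroup S

  IsFinite : Set (c ⊔ ℓ)
  IsFinite = Σ ℕ λ n → Σ (Fin n → Carrier) λ f → ∀ x → ∃ λ i → f i ≈ x

  IsRegular : Set (c ⊔ ℓ)
  IsRegular = ∀ x → ∃ λ y → x ≈ (x ∙ y) ∙ x

  -- x ≤J y : x ∈ S¹ y S¹, unfolding the four cases of adjoined identity
  _≤J_ : Carrier → Carrier → Set (c ⊔ ℓ)
  x ≤J y = (x ≈ y)
         ⊎ (∃ λ a → x ≈ a ∙ y)
         ⊎ (∃ λ b → x ≈ y ∙ b)
         ⊎ (∃ λ a → ∃ λ b → x ≈ (a ∙ y) ∙ b)

module _ {c₁ ℓ₁ c₂ ℓ₂ : Level} (S : Semigroup c₁ ℓ₁) (T : Semigroup c₂ ℓ₂) where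
  private
    module S = Semigroup S
    module T = Semigroup T

  record IsSemigroupHom (ψ : S.Carrier → T.Carrier) : Set (c₁ ⊔ ℓ₁ ⊔ ℓ₂) where
    field
      cong-≈  : ∀ {x y} → x S.≈ y → ψ x T.≈ ψ y
      hom-∙   : ∀ x y → ψ (x S.∙ y) T.≈ ψ x T.∙ ψ y

  IsInjective : (S.Carrier → T.Carrier) → Set (c₁ ⊔ ℓ₁ ⊔ ℓ₂)
  IsInjective ψ = ∀ {x y} → ψ x T.≈ ψ y → x S.≈ y

module Submission where

-- If ψ x ≤J ψ y but not x ≤J y, comparability gives y = a x b, so ψ x and ψ y are
-- J-equivalent in T. In a finite semigroup J-equivalence is stable: u J s u forces
-- u L s u, and w J w c forces w R w c. Hence ψ x L ψ(a x) R ψ y. Regularity of S lets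
-- both relations be written as equations with factors taken from S
-- (x = x z′ z and z = y y′ z for z = a x), which injectivity pulls back to S;
-- combining them gives x = (x z′) y (y′ z).

open import Defs
open import Level using (Level)
open import Algebra.Bundles using (Semigroup)
import Algebra.Properties.Semigroup as SemigroupProperties
open import Data.Sum using (_⊎_; inj₁; inj₂)
open import Data.Product using (_×_; _,_; ∃; ∃₂; proj₁; proj₂)
open import Data.Nat using (ℕ; zero; suc; _+_; _*_)
open import Data.Nat.Properties using (+-identityʳ; +-suc; +-assoc; m≤n⇒∃[o]m+o≡n; n<1+n)
open import Data.Fin using (Fin; toℕ)
open import Data.Fin.Properties using (pigeonhole)
open import Data.Nat.Tactic.RingSolver using (solve-∀)
open import Relation.Binary.PropositionalEquality as ≡ using (_≡_)
import Relation.Binary.Reasoning.Setoid as SetoidReasoning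

module Powers {c ℓ : Level} (G : Semigroup c ℓ) where
  open Semigroup G
  open SetoidReasoning setoid

  -- There is no identity: a ^⁺ k is the (k+1)-st power of a.
  _^⁺_ : Carrier → ℕ → Carrier
  a ^⁺ zero = a
  a ^⁺ suc k = (a ^⁺ k) ∙ a

  ^⁺-+ : ∀ a m n → a ^⁺ m ∙ a ^⁺ n ≈ a ^⁺ suc (m + n)
  ^⁺-+ a m zero = reflexive (≡.cong (λ k → a ^⁺ suc k) (≡.sym (+-identityʳ m)))
  ^⁺-+ a m (suc n) = begin
    a ^⁺ m ∙ (a ^⁺ n ∙ a)   ≈⟨ sym (assoc _ _ _) ⟩
    (a ^⁺ m ∙ a ^⁺ n) ∙ a   ≈⟨ ∙-congʳ (^⁺-+ a m n) ⟩
    a ^⁺ suc (suc (m + n))  ≡⟨ ≡.cong (λ k → a ^⁺ suc k) (≡.sym (+-suc m n)) ⟩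
    a ^⁺ suc (m + suc n)    ∎

  ^⁺-comm : ∀ a k → a ^⁺ k ∙ a ≈ a ∙ a ^⁺ k
  ^⁺-comm a k = sym (^⁺-+ a 0 k)

  module _ {a : Carrier} {i e : ℕ} (repeat : a ^⁺ i ≈ a ^⁺ (i + suc e)) where

    ^⁺-shift : ∀ r → a ^⁺ (i + r) ≈ a ^⁺ (i + suc e + r)
    ^⁺-shift zero = begin
      a ^⁺ (i + 0)          ≡⟨ ≡.cong (a ^⁺_) (+-identityʳ i) ⟩
      a ^⁺ i                ≈⟨ repeat ⟩
      a ^⁺ (i + suc e)      ≡⟨ ≡.cong (a ^⁺_) (≡.sym (+-identityʳ (i + suc e))) ⟩
      a ^⁺ (i + suc e + 0)  ∎
    ^⁺-shift (suc r) = begin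
      a ^⁺ (i + suc r)          ≡⟨ ≡.cong (a ^⁺_) (+-suc i r) ⟩
      a ^⁺ (i + r) ∙ a          ≈⟨ ∙-congʳ (^⁺-shift r) ⟩
      a ^⁺ (i + suc e + r) ∙ a  ≡⟨ ≡.cong (a ^⁺_) (≡.sym (+-suc (i + suc e) r)) ⟩
      a ^⁺ (i + suc e + suc r)  ∎

    ^⁺-periodic : ∀ r n → a ^⁺ (i + r) ≈ a ^⁺ (i + r + n * suc e)
    ^⁺-periodic r zero = reflexive (≡.cong (a ^⁺_) (≡.sym (+-identityʳ (i + r))))
    ^⁺-periodic r (suc n) = begin
      a ^⁺ (i + r)                         ≈⟨ ^⁺-periodic r n ⟩
      a ^⁺ (i + r + n * suc e)             ≡⟨ ≡.cong (a ^⁺_) (+-assoc i r _) ⟩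
      a ^⁺ (i + (r + n * suc e))           ≈⟨ ^⁺-shift _ ⟩
      a ^⁺ (i + suc e + (r + n * suc e))   ≡⟨ ≡.cong (a ^⁺_) (rearrange i e r n) ⟩
      a ^⁺ (i + r + suc n * suc e)         ∎
      where
      rearrange : ∀ i e r n → i + suc e + (r + n * suc e) ≡ i + r + suc n * suc e
      rearrange = solve-∀

    -- With k = i + (1 + i) e, the exponent 2k + 1 of a ^⁺ k ∙ a ^⁺ k is k + (1 + i)(1 + e).
    idempotent-power-of-repeat : ∃ λ k → a ^⁺ k ∙ a ^⁺ k ≈ a ^⁺ k
    idempotent-power-of-repeat = k , (begin
      a ^⁺ k ∙ a ^⁺ k              ≈⟨ ^⁺-+ a k k ⟩
      a ^⁺ suc (k + k)             ≡⟨ ≡.cong (a ^⁺_) (double i e) ⟩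
      a ^⁺ (k + suc i * suc e)     ≈⟨ sym (^⁺-periodic (e + i * e) (suc i)) ⟩
      a ^⁺ k                       ∎)
      where
      k = i + (e + i * e)
      double : ∀ i e → suc (i + (e + i * e) + (i + (e + i * e))) ≡ i + (e + i * e) + suc i * suc e
      double = solve-∀

  ^⁺-factorʳ : ∀ p s k → ∃ λ t → (p ∙ s) ^⁺ k ≈ t ∙ s
  ^⁺-factorʳ p s zero = p , refl
  ^⁺-factorʳ p s (suc k) = (p ∙ s) ^⁺ k ∙ p , sym (assoc _ _ _)

  ^⁺-factorˡ : ∀ c q k → ∃ λ t → (c ∙ q) ^⁺ k ≈ c ∙ t
  ^⁺-factorˡ c q zero = q , refl
  ^⁺-factorˡ c q (suc k) = q ∙ (c ∙ q) ^⁺ k , (begin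
    (c ∙ q) ^⁺ k ∙ (c ∙ q)  ≈⟨ ^⁺-comm (c ∙ q) k ⟩
    (c ∙ q) ∙ (c ∙ q) ^⁺ k  ≈⟨ assoc _ _ _ ⟩
    c ∙ (q ∙ (c ∙ q) ^⁺ k)  ∎)

  sandwich-^⁺ : ∀ {u a b} → u ≈ (a ∙ u) ∙ b → ∀ k → u ≈ (a ^⁺ k ∙ u) ∙ b ^⁺ k
  sandwich-^⁺ u≈aub zero = u≈aub
  sandwich-^⁺ {u} {a} {b} u≈aub (suc k) = begin
    u                                ≈⟨ sandwich-^⁺ u≈aub k ⟩
    (a ^⁺ k ∙ u) ∙ b ^⁺ k            ≈⟨ ∙-congʳ (∙-congˡ u≈aub) ⟩
    (a ^⁺ k ∙ ((a ∙ u) ∙ b)) ∙ b ^⁺ k  ≈⟨ ∙-congʳ (sym (assoc _ _ _)) ⟩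
    ((a ^⁺ k ∙ (a ∙ u)) ∙ b) ∙ b ^⁺ k  ≈⟨ assoc _ _ _ ⟩
    (a ^⁺ k ∙ (a ∙ u)) ∙ (b ∙ b ^⁺ k)  ≈⟨ ∙-cong (sym (assoc _ _ _)) (sym (^⁺-comm b k)) ⟩
    (a ^⁺ suc k ∙ u) ∙ b ^⁺ suc k    ∎

  idempotent-power⇒fixedˡ : ∀ {u a b k} → a ^⁺ k ∙ a ^⁺ k ≈ a ^⁺ k → u ≈ (a ∙ u) ∙ b
                          → a ^⁺ k ∙ u ≈ u
  idempotent-power⇒fixedˡ {u} {a} {b} {k} idem u≈aub = begin
    a ^⁺ k ∙ u                               ≈⟨ ∙-congˡ u≈ ⟩
    a ^⁺ k ∙ ((a ^⁺ k ∙ u) ∙ b ^⁺ k)         ≈⟨ sym (assoc _ _ _) ⟩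
    (a ^⁺ k ∙ (a ^⁺ k ∙ u)) ∙ b ^⁺ k         ≈⟨ ∙-congʳ (trans (sym (assoc _ _ _)) (∙-congʳ idem)) ⟩
    (a ^⁺ k ∙ u) ∙ b ^⁺ k                    ≈⟨ sym u≈ ⟩
    u                                        ∎
    where u≈ = sandwich-^⁺ u≈aub k

  idempotent-power⇒fixedʳ : ∀ {u a b k} → b ^⁺ k ∙ b ^⁺ k ≈ b ^⁺ k → u ≈ (a ∙ u) ∙ b
                          → u ∙ b ^⁺ k ≈ u
  idempotent-power⇒fixedʳ {u} {a} {b} {k} idem u≈aub = begin
    u ∙ b ^⁺ k                               ≈⟨ ∙-congʳ u≈ ⟩
    ((a ^⁺ k ∙ u) ∙ b ^⁺ k) ∙ b ^⁺ k         ≈⟨ assoc _ _ _ ⟩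
    (a ^⁺ k ∙ u) ∙ (b ^⁺ k ∙ b ^⁺ k)         ≈⟨ ∙-congˡ idem ⟩
    (a ^⁺ k ∙ u) ∙ b ^⁺ k                    ≈⟨ sym u≈ ⟩
    u                                        ∎
    where u≈ = sandwich-^⁺ u≈aub k

module Finite {c ℓ : Level} (G : Semigroup c ℓ) (finite : IsFinite G) where
  open Semigroup G
  open SetoidReasoning setoid
  open SemigroupProperties G using ([u∙vw]x≈uv∙wx)
  open Powers G

  private
    n = proj₁ finite
    enum = proj₁ (proj₂ finite)
    onto = proj₂ (proj₂ finite)

  ∃-idempotent-power : ∀ a → ∃ λ k → a ^⁺ k ∙ a ^⁺ k ≈ a ^⁺ k
  ∃-idempotent-power a
    with i , j , i<j , same-index ← pigeonhole (n<1+n n) (λ (i : Fin (suc n)) → proj₁ (onto (a ^⁺ toℕ i)))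
    with e , i+1+e≡j ← m≤n⇒∃[o]m+o≡n i<j
    = idempotent-power-of-repeat {a} {toℕ i} {e} (begin
      a ^⁺ toℕ i                         ≈⟨ sym (proj₂ (onto (a ^⁺ toℕ i))) ⟩
      enum (proj₁ (onto (a ^⁺ toℕ i)))   ≡⟨ ≡.cong enum same-index ⟩
      enum (proj₁ (onto (a ^⁺ toℕ j)))   ≈⟨ proj₂ (onto (a ^⁺ toℕ j)) ⟩
      a ^⁺ toℕ j                         ≡⟨ ≡.cong (a ^⁺_) (≡.trans (≡.sym i+1+e≡j) (≡.sym (+-suc (toℕ i) e))) ⟩
      a ^⁺ (toℕ i + suc e)               ∎)

  stableˡ : ∀ {u a s b} → u ≈ (a ∙ (s ∙ u)) ∙ b → ∃ λ t → u ≈ t ∙ (s ∙ u)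
  stableˡ {u} {a} {s} {b} u≈asub =
    let k , idem = ∃-idempotent-power (a ∙ s)
        t , factor = ^⁺-factorʳ a s k
    in t , (begin
      u                ≈⟨ sym (idempotent-power⇒fixedˡ {k = k} idem (trans u≈asub (∙-congʳ (sym (assoc a s u))))) ⟩
      (a ∙ s) ^⁺ k ∙ u ≈⟨ ∙-congʳ factor ⟩
      (t ∙ s) ∙ u      ≈⟨ assoc _ _ _ ⟩
      t ∙ (s ∙ u)      ∎)

  stableʳ : ∀ {w a c b} → w ≈ (a ∙ (w ∙ c)) ∙ b → ∃ λ t → w ≈ (w ∙ c) ∙ t
  stableʳ {w} {a} {c} {b} w≈awcb =
    let k , idem = ∃-idempotent-power (c ∙ b)
        t , factor = ^⁺-factorˡ c b k
    in t , (begin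
      w                ≈⟨ sym (idempotent-power⇒fixedʳ {k = k} idem (trans w≈awcb ([u∙vw]x≈uv∙wx a w c b))) ⟩
      w ∙ (c ∙ b) ^⁺ k ≈⟨ ∙-congˡ factor ⟩
      w ∙ (c ∙ t)      ≈⟨ sym (assoc _ _ _) ⟩
      (w ∙ c) ∙ t      ∎)

module Regular {c ℓ : Level} (G : Semigroup c ℓ) where
  open Semigroup G
  open SetoidReasoning setoid

  u≈tv⇒u≈uv′∙v : ∀ {u t v v′} → v ≈ (v ∙ v′) ∙ v → u ≈ t ∙ v → u ≈ (u ∙ v′) ∙ v
  u≈tv⇒u≈uv′∙v {u} {t} {v} {v′} v≈vv′v u≈tv = begin
    u                    ≈⟨ u≈tv ⟩
    t ∙ v                ≈⟨ ∙-congˡ v≈vv′v ⟩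
    t ∙ ((v ∙ v′) ∙ v)   ≈⟨ sym (assoc _ _ _) ⟩
    (t ∙ (v ∙ v′)) ∙ v   ≈⟨ ∙-congʳ (sym (assoc _ _ _)) ⟩
    ((t ∙ v) ∙ v′) ∙ v   ≈⟨ ∙-congʳ (∙-congʳ (sym u≈tv)) ⟩
    (u ∙ v′) ∙ v         ∎

  u≈vt⇒u≈vv′∙u : ∀ {u t v v′} → v ≈ (v ∙ v′) ∙ v → u ≈ v ∙ t → u ≈ (v ∙ v′) ∙ u
  u≈vt⇒u≈vv′∙u {u} {t} {v} {v′} v≈vv′v u≈vt = begin
    u                    ≈⟨ u≈vt ⟩
    v ∙ t                ≈⟨ ∙-congʳ v≈vv′v ⟩
    ((v ∙ v′) ∙ v) ∙ t   ≈⟨ assoc _ _ _ ⟩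
    (v ∙ v′) ∙ (v ∙ t)   ≈⟨ ∙-congˡ (sym u≈vt) ⟩
    (v ∙ v′) ∙ u         ∎

  ≤J⇒∃-two-sided : IsRegular G → ∀ {x y} → _≤J_ G x y → ∃₂ λ p q → x ≈ (p ∙ y) ∙ q
  ≤J⇒∃-two-sided regular {x} {y} x≤Jy with y′ , y≈yy′y ← regular y with x≤Jy
  ... | inj₁ x≈y = y ∙ y′ , y′ ∙ y , (begin
    x                          ≈⟨ x≈y ⟩
    y                          ≈⟨ y≈yy′y ⟩
    (y ∙ y′) ∙ y               ≈⟨ ∙-congʳ (∙-congʳ y≈yy′y) ⟩
    (((y ∙ y′) ∙ y) ∙ y′) ∙ y  ≈⟨ assoc _ _ _ ⟩
    ((y ∙ y′) ∙ y) ∙ (y′ ∙ y)  ∎)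
  ... | inj₂ (inj₁ (a , x≈ay)) = a , y′ ∙ y , (begin
    x                   ≈⟨ x≈ay ⟩
    a ∙ y               ≈⟨ ∙-congˡ y≈yy′y ⟩
    a ∙ ((y ∙ y′) ∙ y)  ≈⟨ ∙-congˡ (assoc _ _ _) ⟩
    a ∙ (y ∙ (y′ ∙ y))  ≈⟨ sym (assoc _ _ _) ⟩
    (a ∙ y) ∙ (y′ ∙ y)  ∎)
  ... | inj₂ (inj₂ (inj₁ (b , x≈yb))) = y ∙ y′ , b , trans x≈yb (∙-congʳ y≈yy′y)
  ... | inj₂ (inj₂ (inj₂ (a , b , x≈ayb))) = a , b , x≈ayb

module Homomorphism {c₁ ℓ₁ c₂ ℓ₂ : Level} (S : Semigroup c₁ ℓ₁) (T : Semigroup c₂ ℓ₂)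
  {ψ : Semigroup.Carrier S → Semigroup.Carrier T} (hom : IsSemigroupHom S T ψ) where
  private
    module S = Semigroup S
    module T = Semigroup T
  open IsSemigroupHom hom

  ψ-∙∙ : ∀ x y z → ψ ((x S.∙ y) S.∙ z) T.≈ (ψ x T.∙ ψ y) T.∙ ψ z
  ψ-∙∙ x y z = T.trans (hom-∙ (x S.∙ y) z) (T.∙-congʳ (hom-∙ x y))

  ψ-mono-≤J : ∀ {x y} → _≤J_ S x y → _≤J_ T (ψ x) (ψ y)
  ψ-mono-≤J (inj₁ x≈y) = inj₁ (cong-≈ x≈y)
  ψ-mono-≤J {x} {y} (inj₂ (inj₁ (a , x≈ay))) =
    inj₂ (inj₁ (ψ a , T.trans (cong-≈ x≈ay) (hom-∙ a y)))
  ψ-mono-≤J {x} {y} (inj₂ (inj₂ (inj₁ (b , x≈yb)))) =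
    inj₂ (inj₂ (inj₁ (ψ b , T.trans (cong-≈ x≈yb) (hom-∙ y b))))
  ψ-mono-≤J {x} {y} (inj₂ (inj₂ (inj₂ (a , b , x≈ayb)))) =
    inj₂ (inj₂ (inj₂ (ψ a , ψ b , T.trans (cong-≈ x≈ayb) (ψ-∙∙ a y b))))

  module _ (injective : IsInjective S T ψ) {v v′ : S.Carrier} (v≈vv′v : v S.≈ (v S.∙ v′) S.∙ v) where
    private
      ψv≈ψvψv′ψv : ψ v T.≈ (ψ v T.∙ ψ v′) T.∙ ψ v
      ψv≈ψvψv′ψv = T.trans (cong-≈ v≈vv′v) (ψ-∙∙ v v′ v)

    ψ-reflect-≤L : ∀ {u t} → ψ u T.≈ t T.∙ ψ v → u S.≈ (u S.∙ v′) S.∙ v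
    ψ-reflect-≤L ψu≈tψv = injective (T.trans
      (Regular.u≈tv⇒u≈uv′∙v T ψv≈ψvψv′ψv ψu≈tψv) (T.sym (ψ-∙∙ _ v′ v)))

    ψ-reflect-≤R : ∀ {u t} → ψ u T.≈ ψ v T.∙ t → u S.≈ (v S.∙ v′) S.∙ u
    ψ-reflect-≤R ψu≈ψvt = injective (T.trans
      (Regular.u≈vt⇒u≈vv′∙u T ψv≈ψvψv′ψv ψu≈ψvt) (T.sym (ψ-∙∙ v v′ _)))

module _ {c₁ ℓ₁ c₂ ℓ₂ : Level} (S : Semigroup c₁ ℓ₁) (T : Semigroup c₂ ℓ₂)
  (finiteT : IsFinite T) (regularS : IsRegular S)
  {ψ : Semigroup.Carrier S → Semigroup.Carrier T}
  (hom : IsSemigroupHom S T ψ) (injective : IsInjective S T ψ) where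
  private
    module S = Semigroup S
    module T = Semigroup T
  open IsSemigroupHom hom
  open Homomorphism S T hom
  open Finite T finiteT using (stableˡ; stableʳ)
  open SemigroupProperties T using ([u∙vw]x≈uv∙wx; [uv∙w]x≈u[vw∙x])
  open SetoidReasoning T.setoid

  ψ-reflect-≤J-when-≥J : ∀ {x y a b p q} → y S.≈ (a S.∙ x) S.∙ b → ψ x T.≈ (p T.∙ ψ y) T.∙ q
                       → _≤J_ S x y
  ψ-reflect-≤J-when-≥J {x} {y} {a} {b} {p} {q} y≈axb ψx≈pψyq =
    inj₂ (inj₂ (inj₂ (x S.∙ z′ , y′ S.∙ z , x≈xz′y∙y′z)))
    where
    z = a S.∙ x
    z′ = proj₁ (regularS z)
    y′ = proj₁ (regularS y)

    ψz≈ψaψx : ψ z T.≈ ψ a T.∙ ψ x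
    ψz≈ψaψx = hom-∙ a x

    ψy≈ψzψb : ψ y T.≈ ψ z T.∙ ψ b
    ψy≈ψzψb = T.trans (cong-≈ y≈axb) (hom-∙ z b)

    ψx-sandwich : ψ x T.≈ (p T.∙ (ψ a T.∙ ψ x)) T.∙ (ψ b T.∙ q)
    ψx-sandwich = begin
      ψ x                                    ≈⟨ ψx≈pψyq ⟩
      (p T.∙ ψ y) T.∙ q                      ≈⟨ T.∙-congʳ (T.∙-congˡ ψy≈ψzψb) ⟩
      (p T.∙ (ψ z T.∙ ψ b)) T.∙ q            ≈⟨ [u∙vw]x≈uv∙wx p (ψ z) (ψ b) q ⟩
      (p T.∙ ψ z) T.∙ (ψ b T.∙ q)            ≈⟨ T.∙-congʳ (T.∙-congˡ ψz≈ψaψx) ⟩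
      (p T.∙ (ψ a T.∙ ψ x)) T.∙ (ψ b T.∙ q)  ∎

    ψz-sandwich : ψ z T.≈ ((ψ a T.∙ p) T.∙ (ψ z T.∙ ψ b)) T.∙ q
    ψz-sandwich = begin
      ψ z                                    ≈⟨ ψz≈ψaψx ⟩
      ψ a T.∙ ψ x                            ≈⟨ T.∙-congˡ ψx≈pψyq ⟩
      ψ a T.∙ ((p T.∙ ψ y) T.∙ q)            ≈⟨ T.sym ([uv∙w]x≈u[vw∙x] (ψ a) p (ψ y) q) ⟩
      ((ψ a T.∙ p) T.∙ ψ y) T.∙ q            ≈⟨ T.∙-congʳ (T.∙-congˡ ψy≈ψzψb) ⟩
      ((ψ a T.∙ p) T.∙ (ψ z T.∙ ψ b)) T.∙ q  ∎

    ψx≤Lψz : ∃ λ t → ψ x T.≈ t T.∙ ψ z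
    ψx≤Lψz = let t , ψx≈t∙ψaψx = stableˡ ψx-sandwich
             in t , T.trans ψx≈t∙ψaψx (T.∙-congˡ (T.sym ψz≈ψaψx))

    ψz≤Rψy : ∃ λ t → ψ z T.≈ ψ y T.∙ t
    ψz≤Rψy = let t , ψz≈ψzψb∙t = stableʳ ψz-sandwich
             in t , T.trans ψz≈ψzψb∙t (T.∙-congʳ (T.sym ψy≈ψzψb))

    x≈xz′∙z : x S.≈ (x S.∙ z′) S.∙ z
    x≈xz′∙z = ψ-reflect-≤L injective (proj₂ (regularS z)) (proj₂ ψx≤Lψz)

    z≈yy′∙z : z S.≈ (y S.∙ y′) S.∙ z
    z≈yy′∙z = ψ-reflect-≤R injective (proj₂ (regularS y)) (proj₂ ψz≤Rψy)

    x≈xz′y∙y′z : x S.≈ ((x S.∙ z′) S.∙ y) S.∙ (y′ S.∙ z)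
    x≈xz′y∙y′z = S.trans x≈xz′∙z (S.trans
      (S.∙-congˡ (S.trans z≈yy′∙z (S.assoc y y′ z))) (S.sym (S.assoc (x S.∙ z′) y (y′ S.∙ z))))

lemma5p7 : {c₁ ℓ₁ c₂ ℓ₂ : Level} (S : Semigroup c₁ ℓ₁) (T : Semigroup c₂ ℓ₂)
    → IsFinite S → IsFinite T → IsRegular S → IsRegular T
    → (ψ : Semigroup.Carrier S → Semigroup.Carrier T)
    → IsSemigroupHom S T ψ → IsInjective S T ψ
    → (∀ x y → _≤J_ S x y ⊎ _≤J_ S y x)
    → ∀ x y → (_≤J_ S x y → _≤J_ T (ψ x) (ψ y)) × (_≤J_ T (ψ x) (ψ y) → _≤J_ S x y)
lemma5p7 S T _ finiteT regularS regularT ψ hom injective comparable x y =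
  Homomorphism.ψ-mono-≤J S T hom , reflect
  where
  reflect : _≤J_ T (ψ x) (ψ y) → _≤J_ S x y
  reflect ψx≤Jψy with comparable x y
  ... | inj₁ x≤Jy = x≤Jy
  ... | inj₂ y≤Jx
    with a , b , y≈axb ← Regular.≤J⇒∃-two-sided S regularS y≤Jx
    with p , q , ψx≈pψyq ← Regular.≤J⇒∃-two-sided T regularT ψx≤Jψy
    = ψ-reflect-≤J-when-≥J S T finiteT regularS hom injective y≈axb ψx≈pψyq
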